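{- In the type theory described in the context, for any type $X$ and any classical predicate $P:X\to\mathsf{Prop}$ there are functions in both directions between $\Sigma(x:\mathsf{M}X).\,\forall^{\mathsf{M}}y:x.\,P\,y$ and $\mathsf{M}(\Sigma x:X.\,P\,x)$, i.e. $\big(\Sigma x:\mathsf{M}X.\,\forall^{\mathsf{M}}y:x.\,P\,y\big)\leftrightarrow\mathsf{M}\big(\Sigma x:X.\,P\,x\big)$.
   Context: Work in an extensional dependent type theory with a universe $\mathsf{Type}$ and a universe $\mathsf{Prop}$ of classical propositions (closed under $\to,\times,\Pi$, with classical $\lor,\exists$; identity types in $\mathsf{Prop}$), assuming excluded middle for $\mathsf{Prop}$, propositional extensionality, and functional extensionality. Nondeterminism: a type former $\mathsf{M}:\mathsf{Type}\to\mathsf{Type}$ with $\mathsf{unit}^{\mathsf{M}}$, $\mathsf{mult}^{\mathsf{M}}$, $\mathsf{lift}^{\mathsf{M}}$ satisfying the monad laws. Let $\mathsf{P}_+X:=\Sigma(S:X\to\mathsf{Prop}).\,\exists x.\,S\,x$ (classical nonempty powerset monad). Assume a natural transformation $\mathsf{picture}_X:\mathsf{M}X\to\mathsf{P}_+X$, injective, commuting with units and multiplications, with $\mathsf{lift}^{\mathsf{P}_+}\mathsf{picture}_X$ an equivalence; $\mathsf{pic}_X\,x\,y:=\pi_1(\mathsf{picture}_X\,x)\,y$. Assume a term of type $\prod_{x:\mathsf{M}X}\mathsf{M}(\Sigma y:X.\,\mathsf{pic}_X\,x\,y)$, and that for subsingleton $X$, $\mathsf{unit}^{\mathsf{M}}_X$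 is an equivalence. Define $\wedge^{\mathsf{M}}(z:\mathsf{M}\mathsf{Prop}):=(z=\mathsf{unit}^{\mathsf{M}}\mathsf{True})$ and $\forall^{\mathsf{M}}y:x.\,P\,y:=\wedge^{\mathsf{M}}(\mathsf{lift}^{\mathsf{M}}P\,x)$ (equivalently, every $y$ with $\mathsf{pic}_X\,x\,y$ satisfies $P\,y$). -}

module Defs where

open import Level using (Level; Setω)
open import Data.Product using (Σ; Σ-syntax; _×_; _,_; proj₁; proj₂)
open import Data.Sum using (_⊎_)
open import Data.Unit using (⊤; tt)
open import Data.Empty using (⊥)
open import Relation.Nullary using (¬_)
open import Relation.Binary.PropositionalEquality using (_≡_; refl; cong₂)
open import Axiom.Extensionality.Propositional using (Extensionality)
open import Function using (_∘_; id)

-- The universes.  "Type" is modelled by Set₁; the universe "Prop" of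
-- classical propositions is modelled by the (small) subsingletons,
-- Prop' = Σ (A : Set) (isProp A), which itself lives in Type = Set₁.

Type : Set₂
Type = Set₁

isProp : ∀ {ℓ} → Set ℓ → Set ℓ
isProp A = (a b : A) → a ≡ b

Prop' : Type
Prop' = Σ Set isProp

⟦_⟧ : Prop' → Set
⟦ p ⟧ = proj₁ p

True : Prop'
True = ⊤ , λ _ _ → refl

_∧'_ : Prop' → Prop' → Prop'
p ∧' q = (⟦ p ⟧ × ⟦ q ⟧) , λ { (a , b) (a' , b') → cong₂ _,_ (proj₂ p a a') (proj₂ q b b') }

record Logic : Setω where
  field
    funext  : ∀ {a b} → Extensionality a b
    propext : (p q : Prop') → (⟦ p ⟧ → ⟦ q ⟧) → (⟦ q ⟧ → ⟦ p ⟧) → p ≡ q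
    lem     : (p : Prop') → ⟦ p ⟧ ⊎ ¬ ⟦ p ⟧
    Pi'     : {X : Type} → (X → Prop') → Prop'
    Pi'-in  : {X : Type} {S : X → Prop'} → ((x : X) → ⟦ S x ⟧) → ⟦ Pi' S ⟧
    Pi'-out : {X : Type} {S : X → Prop'} → ⟦ Pi' S ⟧ → (x : X) → ⟦ S x ⟧
    Eq'     : {X : Type} → X → X → Prop'
    Eq'-in  : {X : Type} {x y : X} → x ≡ y → ⟦ Eq' x y ⟧
    Eq'-out : {X : Type} {x y : X} → ⟦ Eq' x y ⟧ → x ≡ y
    Ex'     : {X : Type} → (X → Prop') → Prop'
    Ex'-in  : {X : Type} {S : X → Prop'} → ¬ ¬ (Σ[ x ∈ X ] ⟦ S x ⟧) → ⟦ Ex' S ⟧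
    Ex'-out : {X : Type} {S : X → Prop'} → ⟦ Ex' S ⟧ → ¬ ¬ (Σ[ x ∈ X ] ⟦ S x ⟧)

module PowerSet (L : Logic) where
  open Logic L

  P₊ : Type → Type
  P₊ X = Σ[ S ∈ (X → Prop') ] ⟦ Ex' S ⟧

  unitP : {X : Type} → X → P₊ X
  unitP x = (λ y → Eq' x y) , Ex'-in (λ k → k (x , Eq'-in refl))

  liftP : {X Y : Type} → (X → Y) → P₊ X → P₊ Y
  liftP {X} f (S , e) =
    (λ y → Ex' (λ x → S x ∧' Eq' (f x) y)) ,
    Ex'-in (λ k → Ex'-out e (λ { (x , s) →
      k (f x , Ex'-in (λ k' → k' (x , (s , Eq'-in refl)))) }))

  multP : {X : Type} → P₊ (P₊ X) → P₊ X
  multP {X} (𝒮 , e) =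
    (λ x → Ex' (λ (T : P₊ X) → 𝒮 T ∧' proj₁ T x)) ,
    Ex'-in (λ k → Ex'-out e (λ { (T , s) →
      Ex'-out (proj₂ T) (λ { (x , t) →
        k (x , Ex'-in (λ k' → k' (T , (s , t)))) }) }))

record Assumptions (L : Logic) : Set₂ where
  open PowerSet L
  field
    M    : Type → Type
    unit : {X : Type} → X → M X
    mult : {X : Type} → M (M X) → M X
    lift : {X Y : Type} → (X → Y) → M X → M Y
    lift-id        : {X : Type} (m : M X) → lift id m ≡ m
    lift-∘         : {X Y Z : Type} (g : Y → Z) (f : X → Y) (m : M X) →
                     lift (g ∘ f) m ≡ lift g (lift f m)
    unit-nat       : {X Y : Type} (f : X → Y) (x : X) → lift f (unit x) ≡ unit (f x)
    mult-nat       : {X Y : Type} (f : X → Y) (m : M (M X)) →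
                     lift f (mult m) ≡ mult (lift (lift f) m)
    mult-unit      : {X : Type} (m : M X) → mult (unit m) ≡ m
    mult-lift-unit : {X : Type} (m : M X) → mult (lift unit m) ≡ m
    mult-assoc     : {X : Type} (m : M (M (M X))) → mult (mult m) ≡ mult (lift mult m)
    picture        : {X : Type} → M X → P₊ X
    picture-nat    : {X Y : Type} (f : X → Y) (m : M X) →
                     picture (lift f m) ≡ liftP f (picture m)
    picture-inj    : {X : Type} (m m' : M X) → picture m ≡ picture m' → m ≡ m'
    picture-unit   : {X : Type} (x : X) → picture (unit x) ≡ unitP x
    picture-mult   : {X : Type} (m : M (M X)) →
                     picture (mult m) ≡ multP (liftP picture (picture m))
    liftP-picture-inv  : {X : Type} → P₊ (P₊ X) → P₊ (M X)
    liftP-picture-inv₁ : {X : Type} (a : P₊ (M X)) → liftP-picture-inv (liftP picture a) ≡ a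
    liftP-picture-inv₂ : {X : Type} (b : P₊ (P₊ X)) → liftP picture (liftP-picture-inv b) ≡ b
    select : {X : Type} (x : M X) → M (Σ[ y ∈ X ] ⟦ proj₁ (picture x) y ⟧)
    unit-inv  : {X : Type} → isProp X → M X → X
    unit-inv₁ : {X : Type} (h : isProp X) (x : X) → unit-inv h (unit x) ≡ x
    unit-inv₂ : {X : Type} (h : isProp X) (m : M X) → unit (unit-inv h m) ≡ m

module _ {L : Logic} (A : Assumptions L) where
  open Assumptions A

  pic : {X : Type} → M X → X → Prop'
  pic x y = proj₁ (picture x) y

  ∧M : M Prop' → Type
  ∧M z = z ≡ unit True

  ∀M : {X : Type} → M X → (X → Prop') → Type
  ∀M x P = ∧M (lift P x)

{-# OPTIONS --safe #-}
module Submission where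

open import Defs
open import Data.Product using (Σ; Σ-syntax; _×_; _,_; proj₁; proj₂)
open import Data.Unit using (tt)
open import Data.Unit.Polymorphic using () renaming (⊤ to ⊤₁)
open import Function using (_∘_; const)
open import Relation.Binary.PropositionalEquality
  using (_≡_; refl; sym; trans; cong; cong-app; subst; module ≡-Reasoning)
open ≡-Reasoning

-- From left to right, every point of the picture satisfies P, so the
-- assumed selection M X → M (Σ y. pic x y) can be post-composed with the
-- inclusion into Σ y. P y.  From right to left, lift^M proj₁ forgets the
-- proofs, and ∀^M holds because lift^M sends a constant map to unit^M.

module _ {L : Logic} (A : Assumptions L) where
  open Logic L
  open PowerSet L
  open Assumptions A

  M-isProp : {Y : Type} → isProp Y → isProp (M Y)
  M-isProp h m m' = begin
    m                      ≡⟨ sym (unit-inv₂ h m) ⟩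
    unit (unit-inv h m)    ≡⟨ cong unit (h _ _) ⟩
    unit (unit-inv h m')   ≡⟨ unit-inv₂ h m' ⟩
    m'                     ∎

  -- A constant map factors through ⊤, where M ⊤ has only one element.
  lift-const : {Y Z : Type} (c : Z) (m : M Y) → lift (const c) m ≡ unit c
  lift-const c m = begin
    lift (const c ∘ const tt₁) m         ≡⟨ lift-∘ (const c) (const tt₁) m ⟩
    lift (const c) (lift (const tt₁) m)  ≡⟨ cong (lift (const c)) (M-isProp (λ _ _ → refl) _ _) ⟩
    lift (const c) (unit tt₁)            ≡⟨ unit-nat (const c) tt₁ ⟩
    unit c                               ∎
    where
      tt₁ : ⊤₁
      tt₁ = _

  ∀M-of-everywhere : {Y : Type} (m : M Y) (P : Y → Prop') →
                     ((y : Y) → ⟦ P y ⟧) → ∀M A m P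
  ∀M-of-everywhere m P holds = begin
    lift P m             ≡⟨ cong (λ Q → lift Q m) (funext λ y → propext (P y) True _ λ _ → holds y) ⟩
    lift (const True) m  ≡⟨ lift-const True m ⟩
    unit True            ∎

  ∀M-lift : {Y Z : Type} (f : Y → Z) (m : M Y) (P : Z → Prop') →
            ∀M A m (P ∘ f) → ∀M A (lift f m) P
  ∀M-lift f m P h = trans (sym (lift-∘ P f m)) h

  ∀M-elim : {Y : Type} {m : M Y} {P : Y → Prop'} → ∀M A m P →
            (y : Y) → ⟦ pic A m y ⟧ → ⟦ P y ⟧
  ∀M-elim {m = m} {P} h y y∈m = subst ⟦_⟧ (Eq'-out True≡Py) tt
    where
      picture-P : liftP P (picture m) ≡ unitP True
      picture-P = begin
        liftP P (picture m)  ≡⟨ sym (picture-nat P m) ⟩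
        picture (lift P m)   ≡⟨ cong picture h ⟩
        picture (unit True)  ≡⟨ picture-unit True ⟩
        unitP True           ∎

      True≡Py : ⟦ Eq' True (P y) ⟧
      True≡Py = subst ⟦_⟧ (cong-app (cong proj₁ picture-P) (P y))
                  (Ex'-in λ k → k (y , (y∈m , Eq'-in refl)))

mainTheorem4 : (L : Logic) (A : Assumptions L) (X : Type) (P : X → Prop') →
    ((Σ[ x ∈ Assumptions.M A X ] ∀M A x P) → Assumptions.M A (Σ[ x ∈ X ] ⟦ P x ⟧))
    × (Assumptions.M A (Σ[ x ∈ X ] ⟦ P x ⟧) → Σ[ x ∈ Assumptions.M A X ] ∀M A x P)
mainTheorem4 L A X P = restrict , forget
  where
    open Assumptions A

    restrict : (Σ[ x ∈ M X ] ∀M A x P) → M (Σ[ x ∈ X ] ⟦ P x ⟧)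
    restrict (x , h) = lift (λ (y , y∈x) → y , ∀M-elim A h y y∈x) (select x)

    forget : M (Σ[ x ∈ X ] ⟦ P x ⟧) → Σ[ x ∈ M X ] ∀M A x P
    forget m = lift proj₁ m , ∀M-lift A proj₁ m P (∀M-of-everywhere A m (P ∘ proj₁) proj₂)
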